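{- Let $\mathcal{M}$ be a regular structure and let $\emptyset\ne P\subseteq B(\mathcal{M})$ be closed under lower (respectively, upper) cones, i.e. $\triangle_\mathcal{N}\subseteq P$ (respectively, $\triangledown_\mathcal{N}\subseteq P$) for all $\mathcal{N}\in P$. The following are equivalent: (1) $P$ is an $L$-property; (2) $P$ is a distributive $L$-property (i.e. the sublattice on $P$ is distributive); (3) $P$ is closed under unions (respectively, intersections).
   Context: A structure is regular if it is relational and no two distinct signature symbols have the same interpretation. For a regular $\mathcal{M}$ with universe $M$, $\overline{\mathcal{M}}$ is a maximal regular expansion of $\mathcal{M}$ on $M$ (every finitary relation on $M$ named by exactly one symbol), $B(\mathcal{M})$ is the set of restrictions of $\overline{\mathcal{M}}$ to subsignatures (universe $M$), and $\mathcal{B}(\mathcal{M})$ is the Boolean algebra on it with union $\mathcal{N}_1\cup\mathcal{N}_2$ and intersection $\mathcal{N}_1\cap\mathcal{N}_2$ given by union/intersection of signatures, $\mathcal{N}_1\le\mathcal{N}_2$ iff $\mathcal{N}_2$ expands $\mathcal{N}_1$. $\triangledown_\mathcal{N}=\{\mathcal{K}:\mathcal{N}\le\mathcal{K}\}$, $\triangle_\mathcal{N}=\{\mathcal{K}:\mathcal{K}\le\mathcal{N}\}$. A set $P\subseteq B(\mathcal{M})$ is an $L$-property if it is the universe of a sublattice of the lattice reduct of $\mathcal{B}(\mathcal{M})$, i.e. closed under $\cup$ and $\cap$. -}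

module Defs where

open import Level using (Level; _⊔_) renaming (suc to lsuc; zero to lzero)
open import Data.Nat using (ℕ)
open import Data.Vec using (Vec)
open import Data.Product using (Σ; ∃; _×_; _,_)
open import Data.Sum using (_⊎_)
open import Relation.Binary.PropositionalEquality using (_≡_)

_⟺_ : ∀ {a b} → Set a → Set b → Set (a ⊔ b)
A ⟺ B = (A → B) × (B → A)

FinRel : Set → Set₁
FinRel M = Σ ℕ (λ n → Vec M n → Set)

data _≈R_ {M : Set} : FinRel M → FinRel M → Set₁ where
  same : ∀ {n} {r s : Vec M n → Set} →
         (∀ xs → r xs ⟺ s xs) → (n , r) ≈R (n , s)

record RegularStructure : Set₁ where
  field
    Carrier : Set
    Sym     : Set
    arity   : Sym → ℕ
    interp  : (s : Sym) → Vec Carrier (arity s) → Set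
    regular : ∀ s t → (arity s , interp s) ≈R (arity t , interp t) → s ≡ t

-- B(𝓜): reducts of the maximal regular expansion 𝓜̄ (universe M) to
-- subsignatures.  Since 𝓜̄ names every finitary relation on M by exactly
-- one symbol, its symbols are identified with finitary relations on M
-- (up to ≈R), so a member of B(𝓜) is determined by its signature, a set
-- of finitary relations on M (closed under ≈R).

record B (𝓜 : RegularStructure) : Set₂ where
  open RegularStructure 𝓜
  field
    sig      : FinRel Carrier → Set₁
    sig-resp : ∀ {R S} → R ≈R S → sig R → sig S
open B public

module _ {𝓜 : RegularStructure} where

  _≤B_ : B 𝓜 → B 𝓜 → Set₁
  N₁ ≤B N₂ = ∀ R → sig N₁ R → sig N₂ R

  _≐_ : B 𝓜 → B 𝓜 → Set₁
  N₁ ≐ N₂ = (N₁ ≤B N₂) × (N₂ ≤B N₁)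

  _∪B_ : B 𝓜 → B 𝓜 → B 𝓜
  N₁ ∪B N₂ = record
    { sig = λ R → sig N₁ R ⊎ sig N₂ R
    ; sig-resp = λ { e (Data.Sum.inj₁ x) → Data.Sum.inj₁ (sig-resp N₁ e x)
                   ; e (Data.Sum.inj₂ x) → Data.Sum.inj₂ (sig-resp N₂ e x) } }

  _∩B_ : B 𝓜 → B 𝓜 → B 𝓜
  N₁ ∩B N₂ = record
    { sig = λ R → sig N₁ R × sig N₂ R
    ; sig-resp = λ { e (x , y) → sig-resp N₁ e x , sig-resp N₂ e y } }

  -- Properties P ⊆ B(𝓜), as predicates.  A predicate represents a set of
  -- structures only if it respects equality of structures.
  Property : Set₃
  Property = B 𝓜 → Set₂

  Respects≐ : Property → Set₂
  Respects≐ P = ∀ {N K} → N ≐ K → P N → P K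

  NonEmpty : Property → Set₂
  NonEmpty P = ∃ λ N → P N

  LowerConeClosed : Property → Set₂
  LowerConeClosed P = ∀ N K → P N → K ≤B N → P K

  UpperConeClosed : Property → Set₂
  UpperConeClosed P = ∀ N K → P N → N ≤B K → P K

  UnionClosed : Property → Set₂
  UnionClosed P = ∀ N₁ N₂ → P N₁ → P N₂ → P (N₁ ∪B N₂)

  IntersectionClosed : Property → Set₂
  IntersectionClosed P = ∀ N₁ N₂ → P N₁ → P N₂ → P (N₁ ∩B N₂)

  -- L-property: universe of a sublattice of the lattice reduct of 𝓑(𝓜)
  IsLProperty : Property → Set₂
  IsLProperty P = UnionClosed P × IntersectionClosed P

  IsDistributiveLProperty : Property → Set₂
  IsDistributiveLProperty P =
    IsLProperty P ×
    (∀ a b c → P a → P b → P c → (a ∩B (b ∪B c)) ≐ ((a ∩B b) ∪B (a ∩B c)))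

module Submission where

open import Defs
open import Data.Product using (_×_; _,_; proj₁; proj₂)
open import Data.Sum using (inj₁; inj₂)

-- Union and intersection in B(𝓜) are union and intersection of signatures,
-- so B(𝓜) is a distributive lattice and every L-property is distributive.
-- A lower-cone-closed P is closed under intersections, since N ∩ K lies
-- below N; dually an upper-cone-closed P is closed under unions.  In either
-- case closure under the other operation is all an L-property still needs.

module _ {𝓜 : RegularStructure} where

  ∩B-distribˡ-∪B : ∀ (a b c : B 𝓜) → (a ∩B (b ∪B c)) ≐ ((a ∩B b) ∪B (a ∩B c))
  ∩B-distribˡ-∪B a b c =
      (λ { R (x , inj₁ y) → inj₁ (x , y) ; R (x , inj₂ y) → inj₂ (x , y) })
    , (λ { R (inj₁ (x , y)) → x , inj₁ y ; R (inj₂ (x , y)) → x , inj₂ y })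

  N∩K≤N : ∀ (N K : B 𝓜) → (N ∩B K) ≤B N
  N∩K≤N N K R = proj₁

  N≤N∪K : ∀ (N K : B 𝓜) → N ≤B (N ∪B K)
  N≤N∪K N K R = inj₁

  lowerConeClosed⇒intersectionClosed :
    ∀ {P : Property {𝓜}} → LowerConeClosed P → IntersectionClosed P
  lowerConeClosed⇒intersectionClosed lc N K pN _ = lc N (N ∩B K) pN (N∩K≤N N K)

  upperConeClosed⇒unionClosed :
    ∀ {P : Property {𝓜}} → UpperConeClosed P → UnionClosed P
  upperConeClosed⇒unionClosed uc N K pN _ = uc N (N ∪B K) pN (N≤N∪K N K)

  lProperty⇔distributiveLProperty :
    (P : Property {𝓜}) → IsLProperty P ⟺ IsDistributiveLProperty P
  lProperty⇔distributiveLProperty P =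
    (λ l → l , λ a b c _ _ _ → ∩B-distribˡ-∪B a b c) , proj₁

  lProperty⇔unionClosed :
    ∀ {P : Property {𝓜}} → IntersectionClosed P → IsLProperty P ⟺ UnionClosed P
  lProperty⇔unionClosed ∩-closed = proj₁ , λ ∪-closed → ∪-closed , ∩-closed

  lProperty⇔intersectionClosed :
    ∀ {P : Property {𝓜}} → UnionClosed P → IsLProperty P ⟺ IntersectionClosed P
  lProperty⇔intersectionClosed ∪-closed = proj₂ , λ ∩-closed → ∪-closed , ∩-closed

proposition4p1 : (𝓜 : RegularStructure) (P : Property {𝓜}) →
    Respects≐ P → NonEmpty P →
    (LowerConeClosed P →
    (IsLProperty P ⟺ IsDistributiveLProperty P) × (IsLProperty P ⟺ UnionClosed P))
    ×
    (UpperConeClosed P →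
    (IsLProperty P ⟺ IsDistributiveLProperty P) × (IsLProperty P ⟺ IntersectionClosed P))
proposition4p1 𝓜 P _ _ =
    (λ lc → lProperty⇔distributiveLProperty P
          , lProperty⇔unionClosed (lowerConeClosed⇒intersectionClosed lc))
  , (λ uc → lProperty⇔distributiveLProperty P
          , lProperty⇔intersectionClosed (upperConeClosed⇒unionClosed uc))
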